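{- Let $c$ and $m$ be positive integers with $c>1$. If $m$ divides $c-1$ and $\operatorname{cosocle}(m)>\operatorname{rad}(c)$, then $(1,c^{k}-1,c^{k})$ is an $abc$ triple for each positive integer $k$.
   Context: For a positive integer $n$, $\operatorname{rad}(n)$ denotes the product of the distinct prime factors of $n$ (with $\operatorname{rad}(1)=1$), and $\operatorname{cosocle}(n)=\frac{n}{\operatorname{rad}(n)}$. An $abc$ triple is a triple $(a,b,c)$ of relatively prime positive integers with $a+b=c$ and $\operatorname{rad}(abc)<c$. -}

module Defs where

open import Data.Nat using (ℕ; zero; suc; _+_; _*_; _<_; NonZero)
open import Data.Nat.Base using (_/_)
open import Data.Nat.Properties using (m*n≢0)
open import Data.Nat.Divisibility using (_∣?_)
open import Data.Nat.Primality using (prime?)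
open import Data.Nat.Coprimality using (Coprime)
open import Data.Product using (_×_)
open import Relation.Nullary.Decidable using (does)
open import Data.Bool using (Bool; true; false; if_then_else_; _∧_)

radFrom : ℕ → ℕ → ℕ
radFrom n zero = 1
radFrom n (suc k) =
  (if does (prime? (suc k)) ∧ does (suc k ∣? n) then suc k else 1) * radFrom n k

rad : ℕ → ℕ
rad n = radFrom n n

radFrom-nonZero : ∀ n k → NonZero (radFrom n k)
radFrom-nonZero n zero = _
radFrom-nonZero n (suc k) with does (prime? (suc k)) ∧ does (suc k ∣? n)
... | true  = m*n≢0 (suc k) (radFrom n k) {{_}} {{radFrom-nonZero n k}}
... | false = m*n≢0 1 (radFrom n k) {{_}} {{radFrom-nonZero n k}}


cosocle : ℕ → ℕ
cosocle n = _/_ n (rad n) {{radFrom-nonZero n n}}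

IsABCTriple : ℕ → ℕ → ℕ → Set
IsABCTriple a b c =
  0 < a × 0 < b × 0 < c × Coprime a b × Coprime a c × Coprime b c
  × a + b ≡ c × rad (a * b * c) < c
  where open import Relation.Binary.PropositionalEquality using (_≡_)

-- Write C = c^k and N = C - 1. The primes of N·C are those of N and of c, so
-- rad(N·C) ≤ rad N · rad c < rad N · cosocle m. Since m ∣ c - 1 ∣ N, say N = q·m,
-- rad N ≤ rad q · rad m ≤ q · rad m, hence rad N · cosocle m ≤ q · m = N < C.
module Submission where

open import Defs
open import Data.Nat using (ℕ; _∸_; _^_; _<_; _>_)
open import Data.Nat.Divisibility using (_∣_)

open import Data.Bool using (if_then_else_; _∧_)
open import Data.Nat.Base
open import Data.Nat.Coprimality using (Coprime; coprime-+; 1-coprimeTo)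
import Data.Nat.Coprimality as Coprimality
open import Data.Nat.Divisibility
open import Data.Nat.DivMod using (m/n*n≡m)
open import Data.Nat.Primality using (Prime; prime?; euclidsLemma; ¬prime[1])
open import Data.Nat.Properties
open import Data.Product using (_,_)
open import Data.Sum using (_⊎_; inj₁; inj₂; map₂)
open import Relation.Binary.PropositionalEquality
open import Relation.Nullary using (Dec; yes; no; contradiction)
open import Relation.Nullary.Decidable using (does)

-- radFrom n (suc K) unfolds definitionally to radFactor n (suc K) * radFrom n K.
radFactor : ℕ → ℕ → ℕ
radFactor n p = if does (prime? p) ∧ does (p ∣? n) then p else 1

data RadFactor (n p : ℕ) : ℕ → Set where
  prime-divisor : Prime p → p ∣ n → RadFactor n p p
  other         : (Prime p → p ∤ n) → RadFactor n p 1

radFactor-view : ∀ n p → RadFactor n p (radFactor n p)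
radFactor-view n p = view (prime? p) (p ∣? n)
  where
  view : (p-prime? : Dec (Prime p)) (p∣n? : Dec (p ∣ n)) →
         RadFactor n p (if does p-prime? ∧ does p∣n? then p else 1)
  view (no ¬p-prime) _         = other λ p-prime _ → ¬p-prime p-prime
  view (yes _)       (no p∤n)  = other λ _ → p∤n
  view (yes p-prime) (yes p∣n) = prime-divisor p-prime p∣n

radFactor≡p : ∀ {n p} → Prime p → p ∣ n → radFactor n p ≡ p
radFactor≡p {n} {p} p-prime p∣n with radFactor n p | radFactor-view n p
... | _ | prime-divisor _ _ = refl
... | _ | other p∤n         = contradiction p∣n (p∤n p-prime)

prime∤1 : ∀ {p} → Prime p → p ∤ 1
prime∤1 p-prime p∣1 = ¬prime[1] (subst Prime (∣1⇒≡1 p∣1) p-prime)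

prime∣radFrom⇒≤ : ∀ {p} n K → Prime p → p ∣ radFrom n K → p ≤ K
prime∣radFrom⇒≤ n zero    p-prime p∣1 = contradiction p∣1 (prime∤1 p-prime)
prime∣radFrom⇒≤ n (suc K) p-prime p∣r
  with radFactor n (suc K) | radFactor-view n (suc K)
... | f | view with euclidsLemma f (radFrom n K) p-prime p∣r
...   | inj₂ p∣rest = m≤n⇒m≤1+n (prime∣radFrom⇒≤ n K p-prime p∣rest)
...   | inj₁ p∣f with view
...     | prime-divisor _ _ = ∣⇒≤ p∣f
...     | other _           = contradiction p∣f (prime∤1 p-prime)

-- A new prime factor p does not divide the product r of the smaller ones, so
-- from n = s·r and p ∣ s·r we get p ∣ s and p·r ∣ n.
radFrom∣ : ∀ n K → radFrom n K ∣ n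
radFrom∣ n zero = 1∣ n
radFrom∣ n (suc K) with radFactor n (suc K) | radFactor-view n (suc K)
... | _ | other _ = subst (_∣ n) (sym (*-identityˡ _)) (radFrom∣ n K)
... | _ | prime-divisor p-prime p∣n with radFrom∣ n K
...   | divides s n≡s*r with euclidsLemma s (radFrom n K) p-prime (subst (_ ∣_) n≡s*r p∣n)
...     | inj₁ p∣s =
  subst (suc K * radFrom n K ∣_) (sym n≡s*r) (*-monoˡ-∣ (radFrom n K) p∣s)
...     | inj₂ p∣r = contradiction (prime∣radFrom⇒≤ n K p-prime p∣r) (<⇒≱ (n<1+n K))

rad∣ : ∀ n → rad n ∣ n
rad∣ n = radFrom∣ n n

rad≢0 : ∀ n → NonZero (rad n)
rad≢0 n = radFrom-nonZero n n

radFrom-stable : ∀ {n K} → 0 < n → n ≤′ K → radFrom n K ≡ rad n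
radFrom-stable n>0 ≤′-refl = refl
radFrom-stable {n} {suc K} n>0 (≤′-step n≤′K)
  with radFactor n (suc K) | radFactor-view n (suc K)
... | _ | prime-divisor _ p∣n =
  contradiction p∣n (>⇒∤ {{>-nonZero n>0}} (s≤s (≤′⇒≤ n≤′K)))
... | _ | other _ = trans (*-identityˡ _) (radFrom-stable n>0 n≤′K)

PrimesCoveredBy : ℕ → ℕ → ℕ → Set
PrimesCoveredBy a b d = ∀ {p} → Prime p → p ∣ a → p ∣ b ⊎ p ∣ d

radFactor-∣-* : ∀ {a b d} p → PrimesCoveredBy a b d →
                radFactor a p ∣ radFactor b p * radFactor d p
radFactor-∣-* {a} {b} {d} p cover with radFactor a p | radFactor-view a p
... | _ | other _ = 1∣ _
... | _ | prime-divisor p-prime p∣a with cover p-prime p∣a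
...   | inj₁ p∣b = subst (λ x → p ∣ x * radFactor d p) (sym (radFactor≡p p-prime p∣b))
                     (m∣m*n (radFactor d p))
...   | inj₂ p∣d = subst (λ x → p ∣ radFactor b p * x) (sym (radFactor≡p p-prime p∣d))
                     (n∣m*n (radFactor b p))

radFrom-∣-* : ∀ {a b d} K → PrimesCoveredBy a b d →
              radFrom a K ∣ radFrom b K * radFrom d K
radFrom-∣-* zero _ = ∣-refl
radFrom-∣-* {a} {b} {d} (suc K) cover =
  subst (radFrom a (suc K) ∣_) interchange
    (*-pres-∣ (radFactor-∣-* (suc K) cover) (radFrom-∣-* K cover))
  where
  interchange : radFactor b (suc K) * radFactor d (suc K) * (radFrom b K * radFrom d K)
              ≡ radFrom b (suc K) * radFrom d (suc K)
  interchange = [m*n]*[o*p]≡[m*o]*[n*p]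
    (radFactor b (suc K)) (radFactor d (suc K)) (radFrom b K) (radFrom d K)

rad-∣-* : ∀ {a b d} → 0 < a → 0 < b → 0 < d → PrimesCoveredBy a b d → rad a ∣ rad b * rad d
rad-∣-* {a} {b} {d} a>0 b>0 d>0 cover =
  subst₂ _∣_ (radFrom-stable a>0 (≤⇒≤′ a≤K))
    (cong₂ _*_ (radFrom-stable b>0 (≤⇒≤′ b≤K)) (radFrom-stable d>0 (≤⇒≤′ d≤K)))
    (radFrom-∣-* (a + b + d) cover)
  where
  a≤K : a ≤ a + b + d
  a≤K = ≤-trans (m≤m+n a b) (m≤m+n (a + b) d)
  b≤K : b ≤ a + b + d
  b≤K = ≤-trans (m≤n+m b a) (m≤m+n (a + b) d)
  d≤K : d ≤ a + b + d
  d≤K = m≤n+m d (a + b)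

rad*cosocle≡ : ∀ n → rad n * cosocle n ≡ n
rad*cosocle≡ n = trans (*-comm (rad n) (cosocle n)) (m/n*n≡m {{rad≢0 n}} (rad∣ n))

rad*cosocle≤ : ∀ {m n} → m ∣ n → 0 < n → rad n * cosocle m ≤ n
rad*cosocle≤ {m} (divides q refl) qm>0 = begin
  rad (q * m) * cosocle m   ≤⟨ *-monoˡ-≤ (cosocle m) rad[qm]≤rad[q]*rad[m] ⟩
  rad q * rad m * cosocle m ≤⟨ *-monoˡ-≤ (cosocle m) (*-monoˡ-≤ (rad m) (∣⇒≤ {{q≢0}} (rad∣ q))) ⟩
  q * rad m * cosocle m     ≡⟨ *-assoc q (rad m) (cosocle m) ⟩
  q * (rad m * cosocle m)   ≡⟨ cong (q *_) (rad*cosocle≡ m) ⟩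
  q * m                     ∎
  where
  open ≤-Reasoning
  instance
    qm≢0 : NonZero (q * m)
    qm≢0 = >-nonZero qm>0
  q≢0 : NonZero q
  q≢0 = m*n≢0⇒m≢0 q
  q>0 : 0 < q
  q>0 = >-nonZero⁻¹ q {{q≢0}}
  m>0 : 0 < m
  m>0 = >-nonZero⁻¹ m {{m*n≢0⇒n≢0 q}}
  rad[qm]≤rad[q]*rad[m] : rad (q * m) ≤ rad q * rad m
  rad[qm]≤rad[q]*rad[m] = ∣⇒≤ {{m*n≢0 (rad q) (rad m) {{rad≢0 q}} {{rad≢0 m}}}}
    (rad-∣-* qm>0 q>0 m>0 (euclidsLemma q m))

∣c∸1⇒∣c^k∸1 : ∀ {d} c → d ∣ c ∸ 1 → ∀ k → d ∣ c ^ k ∸ 1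
∣c∸1⇒∣c^k∸1 _         _     zero    = _ ∣0
∣c∸1⇒∣c^k∸1 zero      _     (suc k) = _ ∣0
∣c∸1⇒∣c^k∸1 {d} c@(suc _) d∣c∸1 (suc k) =
  subst (d ∣_) identity (∣m∣n⇒∣m+n (∣n⇒∣m*n c (∣c∸1⇒∣c^k∸1 c d∣c∸1 k)) d∣c∸1)
  where
  open ≡-Reasoning
  c≤c*c^k : c ≤ c * c ^ k
  c≤c*c^k = m≤m*n c (c ^ k) {{m^n≢0 c k}}
  identity : c * (c ^ k ∸ 1) + (c ∸ 1) ≡ c * c ^ k ∸ 1
  identity = begin
    c * (c ^ k ∸ 1) + (c ∸ 1)     ≡⟨ cong (_+ (c ∸ 1)) (*-distribˡ-∸ c (c ^ k) 1) ⟩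
    (c * c ^ k ∸ c * 1) + (c ∸ 1) ≡⟨ cong (λ x → (c * c ^ k ∸ x) + (c ∸ 1)) (*-identityʳ c) ⟩
    (c * c ^ k ∸ c) + (c ∸ 1)     ≡⟨ sym (+-∸-assoc (c * c ^ k ∸ c) (s≤s z≤n)) ⟩
    (c * c ^ k ∸ c) + c ∸ 1       ≡⟨ cong (_∸ 1) (m∸n+n≡m c≤c*c^k) ⟩
    c * c ^ k ∸ 1                 ∎

prime∣m^n⇒prime∣m : ∀ {p} m n → Prime p → p ∣ m ^ n → p ∣ m
prime∣m^n⇒prime∣m m zero    p-prime p∣1 = contradiction p∣1 (prime∤1 p-prime)
prime∣m^n⇒prime∣m m (suc n) p-prime p∣m^[1+n]
  with euclidsLemma m (m ^ n) p-prime p∣m^[1+n]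
... | inj₁ p∣m   = p∣m
... | inj₂ p∣m^n = prime∣m^n⇒prime∣m m n p-prime p∣m^n

rad[n*c^k]≤rad[n]*rad[c] : ∀ n c k → 0 < n → 0 < c → rad (n * c ^ k) ≤ rad n * rad c
rad[n*c^k]≤rad[n]*rad[c] n c k n>0 c>0 =
  ∣⇒≤ {{m*n≢0 (rad n) (rad c) {{rad≢0 n}} {{rad≢0 c}}}} (rad-∣-* ncᵏ>0 n>0 c>0 primes-covered)
  where
  ncᵏ>0 : 0 < n * c ^ k
  ncᵏ>0 = >-nonZero⁻¹ (n * c ^ k) {{m*n≢0 n (c ^ k) {{>-nonZero n>0}} {{m^n≢0 c k {{>-nonZero c>0}}}}}}
  primes-covered : PrimesCoveredBy (n * c ^ k) n c
  primes-covered p-prime p∣ncᵏ =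
    map₂ (prime∣m^n⇒prime∣m c k p-prime) (euclidsLemma n (c ^ k) p-prime p∣ncᵏ)

coprime-pred : ∀ {n} → 0 < n → Coprime (n ∸ 1) n
coprime-pred {n} n>0 =
  Coprimality.sym (subst (λ x → Coprime x (n ∸ 1)) (m∸n+n≡m n>0)
    (coprime-+ (1-coprimeTo (n ∸ 1))))

theorem1 : (c m : ℕ) → 0 < m → c > 1 → m ∣ c ∸ 1 → cosocle m > rad c →
    (k : ℕ) → 0 < k → IsABCTriple 1 (c ^ k ∸ 1) (c ^ k)
theorem1 c m _ c>1 m∣c∸1 cosocle>rad k@(suc k′) _ =
  z<s , N>0 , C>0 , 1-coprimeTo N , 1-coprimeTo C , coprime-pred C>0 , m+[n∸m]≡n C>0 , rad<C
  where
  C N : ℕ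
  C = c ^ k
  N = C ∸ 1
  c>0 : 0 < c
  c>0 = <-trans z<s c>1
  C>0 : 0 < C
  C>0 = m^n>0 c {{>-nonZero c>0}} k
  N>0 : 0 < N
  N>0 = m<n⇒0<n∸m (<-≤-trans c>1 (m≤m*n c (c ^ k′) {{m^n≢0 c k′ {{>-nonZero c>0}}}}))
  rad<C : rad (1 * N * C) < C
  rad<C = begin-strict
    rad (1 * N * C)   ≡⟨ cong (λ x → rad (x * C)) (*-identityˡ N) ⟩
    rad (N * C)       ≤⟨ rad[n*c^k]≤rad[n]*rad[c] N c k N>0 c>0 ⟩
    rad N * rad c     <⟨ *-monoʳ-< (rad N) {{rad≢0 N}} cosocle>rad ⟩
    rad N * cosocle m ≤⟨ rad*cosocle≤ (∣c∸1⇒∣c^k∸1 c m∣c∸1 k) N>0 ⟩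
    N                 <⟨ m<m+n N z<s ⟩
    N + 1             ≡⟨ m∸n+n≡m C>0 ⟩
    C                 ∎
    where open ≤-Reasoning
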